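{- Let $G$ be a connected finite simple graph with at least $2$ vertices. Then $G$ has a connecting transition set of size $\tau(G)$, where \[\tau(G)=\sum_{C} \begin{cases}|C|-2 & \text{if } G[C] \text{ is connected},\\ |C|-1 & \text{otherwise},\end{cases}\] the sum ranging over all co-connected components $C$ of $G$ with $|C|\ge 2$.
   Context: The complement $\bar G$ of $G$ has vertex set $V(G)$ and edge set the non-adjacent pairs of $G$. The co-connected components of $G$ are the vertex sets of the connected components of $\bar G$. $G[C]$ is the subgraph induced by $C$. A transition is a set of two distinct adjacent edges $\{ab,bc\}$ with $a\neq c$, written $abc$. Given a set $T$ of transitions, a walk $(v_1,\dots,v_k)$ is $T$-compatible if for every $i\in[1,k-2]$, either $v_iv_{i+1}v_{i+2}\in T$ or $v_i=v_{i+2}$. $T$ is a connecting transition set of $G$ if for all vertices $u,v$ there is a $T$-compatible walk from $u$ to $v$. -}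

module Defs where

open import Data.Nat using (ℕ; zero; suc; _+_; _∸_; _≤_; _<ᵇ_; _≤ᵇ_)
open import Data.Fin using (Fin; toℕ; _≟_)
open import Data.Bool using (Bool; true; false; not; _∧_; _∨_; if_then_else_)
open import Data.Bool.ListAction using (any; all)
open import Data.Nat.ListAction using (sum)
open import Data.List using (List; []; _∷_; allFin; map; length; head; last; filter)
open import Data.List.Relation.Unary.All using (All)
open import Data.List.Relation.Unary.Any using (Any)
open import Data.List.Relation.Unary.AllPairs using (AllPairs)
open import Data.Maybe using (Maybe; just)
open import Data.Product using (_×_; _,_; Σ)
open import Data.Sum using (_⊎_)
open import Data.Unit using (⊤)
open import Relation.Binary.PropositionalEquality using (_≡_; _≢_)
open import Relation.Nullary using (¬_)
open import Relation.Nullary.Decidable using (⌊_⌋)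

record Graph (n : ℕ) : Set where
  field
    adj    : Fin n → Fin n → Bool
    adj-sym    : ∀ u v → adj u v ≡ adj v u
    adj-irrefl : ∀ v → adj v v ≡ false
open Graph public

module _ {n : ℕ} (G : Graph n) where

  coAdj : Fin n → Fin n → Bool
  coAdj u v = not (adj G u v) ∧ not ⌊ u ≟ v ⌋

  data IsWalk : List (Fin n) → Set where
    single : ∀ v → IsWalk (v ∷ [])
    step   : ∀ u v vs → adj G u v ≡ true → IsWalk (v ∷ vs) → IsWalk (u ∷ v ∷ vs)

  WalkFromTo : Fin n → Fin n → List (Fin n) → Set
  WalkFromTo u v w = IsWalk w × head w ≡ just u × last w ≡ just v

  Connected : Set
  Connected = ∀ u v → Σ (List (Fin n)) (WalkFromTo u v)

  -- Transitions: a transition abc = {ab, bc}, a ≠ c, represented by the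
  -- triple (a , b , c); the triples (a,b,c) and (c,b,a) denote the same transition.
  Triple : Set
  Triple = Fin n × Fin n × Fin n

  IsTransition : Triple → Set
  IsTransition (a , b , c) = adj G a b ≡ true × adj G b c ≡ true × a ≢ c

  SameTransition : Triple → Triple → Set
  SameTransition (a , b , c) (a' , b' , c') =
    (a ≡ a' × b ≡ b' × c ≡ c') ⊎ (a ≡ c' × b ≡ b' × c ≡ a')

  -- A transition set T is a list of transitions without repetition
  -- (up to reversal); its size is the length of the list.
  IsTransitionSet : List Triple → Set
  IsTransitionSet T = All IsTransition T × AllPairs (λ t s → ¬ SameTransition t s) T

  _∈T_ : Triple → List Triple → Set
  t ∈T T = Any (SameTransition t) T

  data Compatible (T : List Triple) : List (Fin n) → Set where
    nil   : Compatible T []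
    one   : ∀ a → Compatible T (a ∷ [])
    two   : ∀ a b → Compatible T (a ∷ b ∷ [])
    more  : ∀ a b c rest → ((a , b , c) ∈T T ⊎ a ≡ c) →
            Compatible T (b ∷ c ∷ rest) → Compatible T (a ∷ b ∷ c ∷ rest)

  IsConnectingTransitionSet : List Triple → Set
  IsConnectingTransitionSet T =
    IsTransitionSet T ×
    (∀ u v → Σ (List (Fin n)) (λ w → WalkFromTo u v w × Compatible T w))

  -- Boolean reachability: reach E S k u v = there is an E-walk of length ≤ k
  -- from u to v all of whose vertices lie in S.
  reach : (Fin n → Fin n → Bool) → (Fin n → Bool) → ℕ → Fin n → Fin n → Bool
  reach E S zero    u v = S u ∧ ⌊ u ≟ v ⌋
  reach E S (suc k) u v =
    reach E S k u v ∨ any (λ w → reach E S k u w ∧ E w v ∧ S v) (allFin n)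

  -- w lies in the co-connected component of v (component of v in the complement).
  -- Walks of length ≤ n suffice, since a shortest walk has length < n.
  coComp : Fin n → Fin n → Bool
  coComp v w = reach coAdj (λ _ → true) n v w

  coCompSize : Fin n → ℕ
  coCompSize v = length (filter (λ w → coComp v w ≡? true) (allFin n))
    where
    open import Data.Bool.Properties using () renaming (_≟_ to _≡?_)

  -- G[C] is connected, for C the co-connected component of v.
  inducedConnected : Fin n → Bool
  inducedConnected v =
    all (λ a → all (λ b → not (coComp v a ∧ coComp v b) ∨ reach (adj G) (coComp v) n a b)
                   (allFin n)) (allFin n)

  isRep : Fin n → Bool
  isRep v = not (any (λ w → (toℕ w <ᵇ toℕ v) ∧ coComp v w) (allFin n))

  contribution : Fin n → ℕ
  contribution v =
    if isRep v ∧ (2 ≤ᵇ coCompSize v)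
    then (if inducedConnected v then coCompSize v ∸ 2 else coCompSize v ∸ 1)
    else 0

  -- τ(G): sum over co-connected components C with |C| ≥ 2 (each counted once,
  -- via its least vertex).
  τ : ℕ
  τ = sum (map contribution (allFin n))

-- Two vertices of different co-connected components are adjacent, so two distinct
-- non-adjacent vertices u, v lie in a common co-connected component C with |C| ≥ 2.
-- It therefore suffices to choose, for each such C, transitions with both ends in C
-- and an arc h₁h₂ from which a compatible walk reaches every vertex of C: from u,
-- follow such a walk backwards to h₁, turn around, and follow the walk to v.
-- If G[C] is connected, grow a tree inside C from the edge h₁h₂: a new leaf w
-- attached to s gets the transition y s w, where ys is the last arc of the walk to s;
-- this costs |C| - 2 transitions. Otherwise C ≠ V(G) (G is connected), and any
-- x ∉ C is adjacent to all of C, so the |C| - 1 transitions c₁ x c (c ∈ C, c ≠ c₁)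
-- do the job. Transitions chosen for different components have no end vertex in
-- common, so together they form a transition set of size τ(G).
module Submission where

open import Defs
open import Data.Bool using (Bool; true; false; not; _∧_; _∨_; if_then_else_; T)
open import Data.Bool.Properties using (T-≡; ¬-not) renaming (_≟_ to _≟ᵇ_)
open import Data.Bool.ListAction using (any; all)
open import Data.Fin using (Fin; toℕ; _≟_)
open import Data.Fin.Properties using (toℕ-injective; all?; ¬∀⟶∃¬)
open import Data.List using (List; []; _∷_; allFin; map; concat; length; head; last; filter)
open import Data.List.Membership.Propositional using (_∈_; _∉_; lose)
open import Data.List.Membership.Propositional.Properties using (∈-allFin; ∈-filter⁺)
open import Data.List.Properties using (length-++; length-map; length-filter; length-tabulate)
open import Data.List.Relation.Unary.All as All using (All; []; _∷_)
open import Data.List.Relation.Unary.All.Properties as All using (all-filter)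
open import Data.List.Relation.Unary.AllPairs as AllPairs using (AllPairs; []; _∷_)
import Data.List.Relation.Unary.AllPairs.Properties as AllPairs
open import Data.List.Relation.Unary.Any as Any using (here; there)
import Data.List.Relation.Unary.Any.Properties as Any
open import Data.List.Relation.Unary.Unique.Propositional using (Unique)
open import Data.List.Relation.Unary.Unique.Propositional.Properties using (allFin⁺; filter⁺)
open import Data.Maybe using (just)
open import Data.Nat
  using ( ℕ; zero; suc; _+_; _∸_; _≤_; _<_; _≤′_; ≤′-refl; ≤′-step; z≤n; s≤s; z<s; s≤s⁻¹
        ; _<ᵇ_; _≤ᵇ_)
open import Data.Nat.ListAction using (sum)
open import Data.Nat.Properties hiding (_≟_)
open import Data.Nat.Properties using () renaming (_≟_ to _≟ℕ_)
open import Data.Product using (Σ; _×_; _,_; proj₁; proj₂)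
open import Data.Sum using (_⊎_; inj₁; inj₂; [_,_]′)
open import Function.Bundles using (Equivalence)
open import Relation.Binary.Definitions using (tri<; tri≈; tri>)
open import Relation.Binary.PropositionalEquality
  using (_≡_; _≢_; refl; sym; trans; cong; cong₂; subst)
open import Function using (_∘_)
open import Relation.Nullary using (¬_; yes; no; contradiction)
open import Relation.Nullary.Decidable using (⌊_⌋)

absurd-bool : ∀ {b} {B : Set} → b ≡ true → b ≡ false → B
absurd-bool refl ()

T⇒≡true : ∀ {b} → T b → b ≡ true
T⇒≡true = Equivalence.to T-≡

≡true⇒T : ∀ {b} → b ≡ true → T b
≡true⇒T = Equivalence.from T-≡

∨-introˡ : ∀ {a} b → a ≡ true → a ∨ b ≡ true
∨-introˡ b refl = refl

∨-introʳ : ∀ a {b} → b ≡ true → a ∨ b ≡ true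
∨-introʳ true  _ = refl
∨-introʳ false e = e

∨-elim : ∀ a {b} → a ∨ b ≡ true → a ≡ true ⊎ b ≡ true
∨-elim true  _ = inj₁ refl
∨-elim false e = inj₂ e

∧-intro : ∀ {a b} → a ≡ true → b ≡ true → a ∧ b ≡ true
∧-intro refl refl = refl

∧-elimˡ : ∀ a {b} → a ∧ b ≡ true → a ≡ true
∧-elimˡ true  _ = refl
∧-elimˡ false ()

∧-elimʳ : ∀ a {b} → a ∧ b ≡ true → b ≡ true
∧-elimʳ true  e = e
∧-elimʳ false ()

not-true : ∀ {a} → not a ≡ true → a ≡ false
not-true {false} _ = refl

not-false : ∀ {a} → not a ≡ false → a ≡ true
not-false {true} _ = refl

implication-elim : ∀ {a b c} → not (a ∧ b) ∨ c ≡ true → a ≡ true → b ≡ true → c ≡ true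
implication-elim e refl refl = e

module _ {A : Set} (p : A → Bool) where

  any-intro : ∀ {x} xs → x ∈ xs → p x ≡ true → any p xs ≡ true
  any-intro (y ∷ ys) (here refl) e = ∨-introˡ _ e
  any-intro (y ∷ ys) (there x∈ys) e = ∨-introʳ (p y) (any-intro ys x∈ys e)

  any-elim : ∀ xs → any p xs ≡ true → Σ A λ x → p x ≡ true
  any-elim (y ∷ ys) e = [ (λ py → y , py) , any-elim ys ]′ (∨-elim (p y) e)

  all-intro : ∀ xs → (∀ x → p x ≡ true) → all p xs ≡ true
  all-intro []       _ = refl
  all-intro (y ∷ ys) h = ∧-intro (h y) (all-intro ys h)

  all-elim : ∀ {x} xs → all p xs ≡ true → x ∈ xs → p x ≡ true
  all-elim (y ∷ ys) e (here refl)  = ∧-elimˡ (p y) e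
  all-elim (y ∷ ys) e (there x∈ys) = all-elim ys (∧-elimʳ (p y) e) x∈ys

module _ {k : ℕ} where

  ≟-refl : (u : Fin k) → ⌊ u ≟ u ⌋ ≡ true
  ≟-refl u with u ≟ u
  ... | yes _  = refl
  ... | no u≢u = contradiction refl u≢u

  ≟-sound : {u v : Fin k} → ⌊ u ≟ v ⌋ ≡ true → u ≡ v
  ≟-sound {u} {v} e with u ≟ v
  ... | yes u≡v = u≡v

  ≟-≢ : {u v : Fin k} → u ≢ v → ⌊ u ≟ v ⌋ ≡ false
  ≟-≢ {u} {v} u≢v with u ≟ v
  ... | yes u≡v = contradiction u≡v u≢v
  ... | no _    = refl

  ≟-sym : (u v : Fin k) → ⌊ u ≟ v ⌋ ≡ ⌊ v ≟ u ⌋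
  ≟-sym u v with u ≟ v | v ≟ u
  ... | yes _   | yes _   = refl
  ... | no _    | no _    = refl
  ... | yes u≡v | no v≢u  = contradiction (sym u≡v) v≢u
  ... | no u≢v  | yes v≡u = contradiction (sym v≡u) u≢v

_⊆ᵇ_ : {A : Set} → (A → Bool) → (A → Bool) → Set
P ⊆ᵇ Q = ∀ x → P x ≡ true → Q x ≡ true

∅ : {A : Set} → A → Bool
∅ _ = false

insert : ∀ {k} → Fin k → (Fin k → Bool) → Fin k → Bool
insert w P x = P x ∨ ⌊ x ≟ w ⌋

module _ {k : ℕ} (w : Fin k) (P : Fin k → Bool) where

  insert-here : insert w P w ≡ true
  insert-here = ∨-introʳ (P w) (≟-refl w)

  insert-there : ∀ {x} → P x ≡ true → insert w P x ≡ true
  insert-there = ∨-introˡ _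

  insert-elim : ∀ x → insert w P x ≡ true → P x ≡ true ⊎ x ≡ w
  insert-elim x e = [ inj₁ , (λ x≟w → inj₂ (≟-sound x≟w)) ]′ (∨-elim (P x) e)

pair-elim : ∀ {k} (u v x : Fin k) → insert v (insert u ∅) x ≡ true → x ≡ u ⊎ x ≡ v
pair-elim u v x x∈ = [ (λ x≟u → inj₁ (≟-sound x≟u)) , inj₂ ]′ (insert-elim v (insert u ∅) x x∈)

module _ {A : Set} where

  -- Defined as in coCompSize, which is therefore count (coComp G r) (allFin n) by definition.
  count : (A → Bool) → List A → ℕ
  count p xs = length (filter (λ x → p x ≟ᵇ true) xs)

  count-∅ : ∀ xs → count ∅ xs ≡ 0
  count-∅ []       = refl
  count-∅ (_ ∷ xs) = count-∅ xs

  count-mono : ∀ {P Q} xs → P ⊆ᵇ Q → count P xs ≤ count Q xs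
  count-mono [] _ = z≤n
  count-mono {P} {Q} (x ∷ xs) P⊆Q with P x in px | Q x in qx
  ... | true  | true  = s≤s (count-mono xs P⊆Q)
  ... | true  | false = absurd-bool (P⊆Q x px) qx
  ... | false | true  = m≤n⇒m≤1+n (count-mono xs P⊆Q)
  ... | false | false = count-mono xs P⊆Q

  count-mono-< : ∀ {P Q w} xs → P ⊆ᵇ Q → w ∈ xs → Q w ≡ true → P w ≡ false →
                 count P xs < count Q xs
  count-mono-< (x ∷ xs) P⊆Q (here refl) qw pw rewrite qw | pw =
    s≤s (count-mono xs P⊆Q)
  count-mono-< {P} {Q} (x ∷ xs) P⊆Q (there w∈xs) qw pw with P x in px | Q x in qx
  ... | true  | true  = s≤s (count-mono-< xs P⊆Q w∈xs qw pw)
  ... | true  | false = absurd-bool (P⊆Q x px) qx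
  ... | false | true  = m≤n⇒m≤1+n (count-mono-< xs P⊆Q w∈xs qw pw)
  ... | false | false = count-mono-< xs P⊆Q w∈xs qw pw

  count-≡⇒⊇ : ∀ {P Q w} xs → P ⊆ᵇ Q → count P xs ≡ count Q xs → w ∈ xs → Q w ≡ true →
              P w ≡ true
  count-≡⇒⊇ {P} {w = w} xs P⊆Q eq w∈xs qw with P w in pw
  ... | true  = refl
  ... | false = contradiction (count-mono-< xs P⊆Q w∈xs qw pw) (<-irrefl eq)

  count-<⇒witness : ∀ {P Q} xs → count P xs < count Q xs → Σ A λ x → Q x ≡ true × P x ≡ false
  count-<⇒witness {P} {Q} (x ∷ xs) lt with P x in px | Q x in qx
  ... | true  | true  = count-<⇒witness xs (s≤s⁻¹ lt)
  ... | true  | false = count-<⇒witness xs (<⇒≤ lt)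
  ... | false | true  = x , qx , px
  ... | false | false = count-<⇒witness xs lt

module _ {k : ℕ} {P : Fin k → Bool} {w : Fin k} where

  count-insert-∉ : ∀ xs → w ∉ xs → count (insert w P) xs ≡ count P xs
  count-insert-∉ [] _ = refl
  count-insert-∉ (x ∷ xs) w∉ with P x | x ≟ w
  ... | _     | yes refl = contradiction (here refl) w∉
  ... | true  | no _     = cong suc (count-insert-∉ xs (λ w∈xs → w∉ (there w∈xs)))
  ... | false | no _     = count-insert-∉ xs (λ w∈xs → w∉ (there w∈xs))

  count-insert-∈ : ∀ xs → Unique xs → w ∈ xs → P w ≡ false →
                   count (insert w P) xs ≡ suc (count P xs)
  count-insert-∈ (x ∷ xs) (x∉xs ∷ _) (here refl) pw rewrite pw | ≟-refl w =
    cong suc (count-insert-∉ xs (λ w∈xs → All.lookup x∉xs w∈xs refl))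
  count-insert-∈ (x ∷ xs) (x∉xs ∷ unique) (there w∈xs) pw with P x | x ≟ w
  ... | _     | yes refl = contradiction refl (All.lookup x∉xs w∈xs)
  ... | true  | no _     = cong suc (count-insert-∈ xs unique w∈xs pw)
  ... | false | no _     = count-insert-∈ xs unique w∈xs pw

module _ {k : ℕ} where

  count-insert : ∀ P w → P w ≡ false → count (insert w P) (allFin k) ≡ suc (count P (allFin k))
  count-insert P w = count-insert-∈ (allFin k) (allFin⁺ k) (∈-allFin w)

  count-singleton : (u : Fin k) → count (insert u ∅) (allFin k) ≡ 1
  count-singleton u = trans (count-insert ∅ u refl) (cong suc (count-∅ (allFin k)))

  count-pair : {u v : Fin k} → u ≢ v → count (insert v (insert u ∅)) (allFin k) ≡ 2
  count-pair {u} {v} u≢v =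
    trans (count-insert (insert u ∅) v (≟-≢ (λ v≡u → u≢v (sym v≡u)))) (cong suc (count-singleton u))

  count-≤-size : ∀ P → count P (allFin k) ≤ k
  count-≤-size P =
    subst (count P (allFin k) ≤_) (length-tabulate (λ i → i)) (length-filter _ (allFin k))

  two≤count : ∀ {P u v} → u ≢ v → P u ≡ true → P v ≡ true → 2 ≤ count P (allFin k)
  two≤count {P} {u} {v} u≢v pu pv =
    subst (_≤ count P (allFin k)) (count-pair u≢v) (count-mono (allFin k) pair⊆P)
    where
    pair⊆P : insert v (insert u ∅) ⊆ᵇ P
    pair⊆P x x∈ with pair-elim u v x x∈
    ... | inj₁ refl = pu
    ... | inj₂ refl = pv

  member : ∀ {P} → 1 ≤ count P (allFin k) → Σ (Fin k) λ r → P r ≡ true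
  member {P} P≥1 =
    let r , pr , _ = count-<⇒witness {P = ∅} (allFin k)
                       (subst (_< count P (allFin k)) (sym (count-∅ (allFin k))) P≥1)
    in r , pr

  other-member : ∀ {P} r → 2 ≤ count P (allFin k) →
                 Σ (Fin k) λ c → P c ≡ true × insert r ∅ c ≡ false
  other-member {P} r P≥2 =
    count-<⇒witness (allFin k) (subst (_< count P (allFin k)) (sym (count-singleton r)) P≥2)

length-concat-map : {A B : Set} {f : A → List B} {g : A → ℕ} → (∀ x → length (f x) ≡ g x) →
                    ∀ xs → length (concat (map f xs)) ≡ sum (map g xs)
length-concat-map eq []       = refl
length-concat-map {f = f} eq (x ∷ xs) =
  trans (length-++ (f x)) (cong₂ _+_ (eq x) (length-concat-map eq xs))

monotone⇒plateau-or-climb : (f : ℕ → ℕ) → (∀ k → f k ≤ f (suc k)) →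
                            ∀ k → (Σ ℕ λ j → j < k × f j ≡ f (suc j)) ⊎ k ≤ f k
monotone⇒plateau-or-climb f mono zero = inj₂ z≤n
monotone⇒plateau-or-climb f mono (suc k) with monotone⇒plateau-or-climb f mono k
... | inj₁ (j , j<k , eq) = inj₁ (j , m<n⇒m<1+n j<k , eq)
... | inj₂ k≤fk with f k ≟ℕ f (suc k)
... | yes eq  = inj₁ (k , n<1+n k , eq)
... | no  neq = inj₂ (≤-trans (s≤s k≤fk) (≤∧≢⇒< (mono k) neq))

monotone-bounded⇒plateau : (f : ℕ → ℕ) (b : ℕ) → (∀ k → f k ≤ f (suc k)) →
                           (∀ k → f k ≤ b) → Σ ℕ λ j → j ≤ b × f j ≡ f (suc j)
monotone-bounded⇒plateau f b mono bound with monotone⇒plateau-or-climb f mono (suc b)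
... | inj₁ (j , j<1+b , eq) = j , s≤s⁻¹ j<1+b , eq
... | inj₂ 1+b≤f = contradiction (≤-trans 1+b≤f (bound (suc b))) 1+n≰n

-- Bounded reachability

module Reach {n : ℕ} (G : Graph n) (E : Fin n → Fin n → Bool) (S : Fin n → Bool) where

  -- A record, so that k, u and v can be inferred from a proof.
  record Reachable (k : ℕ) (u v : Fin n) : Set where
    constructor reachable
    field holds : reach G E S k u v ≡ true
  open Reachable public

  reach-zero-view : ∀ {u v} → Reachable 0 u v → S u ≡ true × u ≡ v
  reach-zero-view {u} (reachable e) = ∧-elimˡ (S u) e , ≟-sound (∧-elimʳ (S u) e)

  reach-suc-view : ∀ {k u v} → Reachable (suc k) u v →
                   Reachable k u v ⊎ Σ (Fin n) λ w → Reachable k u w × E w v ≡ true × S v ≡ true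
  reach-suc-view {k} {u} {v} (reachable e) with ∨-elim (reach G E S k u v) e
  ... | inj₁ r = inj₁ (reachable r)
  ... | inj₂ r with any-elim _ (allFin n) r
  ... | w , q = inj₂ (w , reachable (∧-elimˡ (reach G E S k u w) q) ,
                      ∧-elimˡ (E w v) (∧-elimʳ (reach G E S k u w) q) ,
                      ∧-elimʳ (E w v) (∧-elimʳ (reach G E S k u w) q))

  reach-refl : ∀ {u} → S u ≡ true → Reachable 0 u u
  reach-refl {u} s = reachable (∧-intro s (≟-refl u))

  reach-suc : ∀ {k u v} → Reachable k u v → Reachable (suc k) u v
  reach-suc (reachable r) = reachable (∨-introˡ _ r)

  reach-suc-⊆ : ∀ k u → reach G E S k u ⊆ᵇ reach G E S (suc k) u
  reach-suc-⊆ k u v r = holds (reach-suc {k} {u} {v} (reachable r))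

  reach-mono : ∀ {k m u v} → k ≤ m → Reachable k u v → Reachable m u v
  reach-mono k≤m = go (≤⇒≤′ k≤m)
    where
    go : ∀ {k m u v} → k ≤′ m → Reachable k u v → Reachable m u v
    go ≤′-refl          r = r
    go (≤′-step k≤′m) r = reach-suc (go k≤′m r)

  reach-snoc : ∀ {k u w v} → Reachable k u w → E w v ≡ true → S v ≡ true → Reachable (suc k) u v
  reach-snoc {k} {u} {w} {v} (reachable r) e s = reachable
    (∨-introʳ (reach G E S k u v) (any-intro _ (allFin n) (∈-allFin w) (∧-intro r (∧-intro e s))))

  reach-++ : ∀ {a b u v w} → Reachable a u v → Reachable b v w → Reachable (b + a) u w
  reach-++ {b = zero} p q with reach-zero-view q
  ... | _ , refl = p
  reach-++ {b = suc b} p q with reach-suc-view q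
  ... | inj₁ q′              = reach-suc (reach-++ p q′)
  ... | inj₂ (_ , q′ , e , s) = reach-snoc (reach-++ p q′) e s

  reach-target : ∀ {k u v} → Reachable k u v → S v ≡ true
  reach-target {zero} r with reach-zero-view r
  ... | s , refl = s
  reach-target {suc k} r with reach-suc-view r
  ... | inj₁ r′              = reach-target r′
  ... | inj₂ (_ , _ , _ , s) = s

  reach-sym : (∀ a b → E a b ≡ E b a) → ∀ {k u v} → Reachable k u v → Reachable k v u
  reach-sym E-sym {zero} r with reach-zero-view r
  ... | _ , refl = r
  reach-sym E-sym {suc k} {u} {v} r with reach-suc-view r
  ... | inj₁ r′ = reach-suc (reach-sym E-sym r′)
  ... | inj₂ (w , r′ , e , s) =
    subst (λ j → Reachable j v u) (+-comm k 1)
      (reach-++ (reach-snoc (reach-refl s) (trans (E-sym v w) e) (reach-target r′)) (reach-sym E-sym r′))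

  reach-exit : (P : Fin n → Bool) → ∀ {k a b} → Reachable k a b → P a ≡ true → P b ≡ false →
               Σ (Fin n) λ s → Σ (Fin n) λ w → P s ≡ true × P w ≡ false × E s w ≡ true × S w ≡ true
  reach-exit P {zero} r pa pb with reach-zero-view r
  ... | _ , refl = absurd-bool pa pb
  reach-exit P {suc k} {b = b} r pa pb with reach-suc-view r
  ... | inj₁ r′ = reach-exit P r′ pa pb
  ... | inj₂ (x , r′ , e , s) with P x in px
  ... | true  = x , b , px , pb , e , s
  ... | false = reach-exit P r′ pa px

  closed⇒bounded : ∀ {j u} → (∀ {w} → Reachable (suc j) u w → Reachable j u w) →
                   ∀ {k w} → Reachable k u w → Reachable j u w
  closed⇒bounded closed {zero} r = reach-mono z≤n r
  closed⇒bounded closed {suc k} r with reach-suc-view r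
  ... | inj₁ r′              = closed⇒bounded closed r′
  ... | inj₂ (_ , r′ , e , s) = closed (reach-snoc (closed⇒bounded closed r′) e s)

  -- The number of vertices reached within j steps is monotone in j and at most n, so it
  -- stops growing at some j ≤ n; from then on nothing new is reached.
  reach-saturates : ∀ {k u v} → Reachable k u v → Reachable n u v
  reach-saturates {u = u} r
    with monotone-bounded⇒plateau (λ j → count (reach G E S j u) (allFin n)) n
           (λ j → count-mono (allFin n) (reach-suc-⊆ j u)) (λ j → count-≤-size (reach G E S j u))
  ... | j , j≤n , plateau = reach-mono j≤n (closed⇒bounded closed r)
    where
    closed : ∀ {w} → Reachable (suc j) u w → Reachable j u w
    closed {w} (reachable r′) =
      reachable (count-≡⇒⊇ (allFin n) (reach-suc-⊆ j u) plateau (∈-allFin w) r′)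

walk⇒reach : ∀ {n} (G : Graph n) (S : Fin n → Bool) → (∀ v → S v ≡ true) →
             ∀ {a b} xs → IsWalk G xs → head xs ≡ just a → last xs ≡ just b →
             Σ ℕ λ k → Reach.Reachable G (adj G) S k a b
walk⇒reach G S full .(v ∷ []) (single v) refl refl = 0 , reach-refl (full v)
  where open Reach G (adj G) S
walk⇒reach G S full .(u ∷ v ∷ vs) (step u v vs uv walk) refl end
  with walk⇒reach G S full (v ∷ vs) walk refl end
... | k , r = k + 1 , reach-++ (reach-snoc (reach-refl (full u)) uv (full v)) r
  where open Reach G (adj G) S

-- Co-connected components

module CoComponents {n : ℕ} (G : Graph n) where
  open Reach G (coAdj G) (λ _ → true)

  coAdj-sym : ∀ a b → coAdj G a b ≡ coAdj G b a
  coAdj-sym a b rewrite adj-sym G a b | ≟-sym a b = refl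

  nonadjacent⇒coAdj : ∀ {u v} → adj G u v ≡ false → u ≢ v → coAdj G u v ≡ true
  nonadjacent⇒coAdj uv u≢v rewrite uv | ≟-≢ u≢v = refl

  reachable⇒coComp : ∀ {u v} → Reachable n u v → coComp G u v ≡ true
  reachable⇒coComp = holds

  coComp⇒reachable : ∀ {u v} → coComp G u v ≡ true → Reachable n u v
  coComp⇒reachable = reachable

  coComp-refl : ∀ v → coComp G v v ≡ true
  coComp-refl v = reachable⇒coComp (reach-mono z≤n (reach-refl refl))

  coComp-sym : ∀ {u v} → coComp G u v ≡ true → coComp G v u ≡ true
  coComp-sym uv = reachable⇒coComp (reach-sym coAdj-sym (coComp⇒reachable uv))

  coComp-trans : ∀ {u v w} → coComp G u v ≡ true → coComp G v w ≡ true → coComp G u w ≡ true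
  coComp-trans uv vw =
    reachable⇒coComp (reach-saturates (reach-++ (coComp⇒reachable uv) (coComp⇒reachable vw)))

  coAdj⇒coComp : ∀ {u v} → coAdj G u v ≡ true → coComp G u v ≡ true
  coAdj⇒coComp uv = reachable⇒coComp (reach-saturates (reach-snoc (reach-refl refl) uv refl))

  outside⇒adjacent : ∀ {r c x} → coComp G r c ≡ true → coComp G r x ≡ false → adj G x c ≡ true
  outside⇒adjacent {r} {c} {x} rc rx with adj G x c in xc
  ... | true  = refl
  ... | false = absurd-bool
    (coComp-trans rc (coAdj⇒coComp (nonadjacent⇒coAdj (trans (adj-sym G c x) xc) c≢x))) rx
    where
    c≢x : c ≢ x
    c≢x refl = absurd-bool rc rx

  isRep-minimal : ∀ {r r′} → isRep G r ≡ true → coComp G r r′ ≡ true → ¬ toℕ r′ < toℕ r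
  isRep-minimal {r} {r′} rep rr′ r′<r =
    absurd-bool (any-intro _ (allFin n) (∈-allFin r′) (∧-intro (T⇒≡true (<⇒<ᵇ r′<r)) rr′))
                (not-true rep)

  isRep-unique : ∀ {r r′} → isRep G r ≡ true → isRep G r′ ≡ true → coComp G r r′ ≡ true →
                 r ≡ r′
  isRep-unique {r} {r′} rep rep′ rr′ with <-cmp (toℕ r) (toℕ r′)
  ... | tri< r<r′ _ _ = contradiction r<r′ (isRep-minimal rep′ (coComp-sym rr′))
  ... | tri≈ _ r≡r′ _ = toℕ-injective r≡r′
  ... | tri> _ _ r′<r = contradiction r′<r (isRep-minimal rep rr′)

  representative : ∀ u → Σ (Fin n) λ r → isRep G r ≡ true × coComp G r u ≡ true
  representative u = descend (suc (toℕ u)) u ≤-refl (coComp-refl u)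
    where
    descend : ∀ bound c → toℕ c < bound → coComp G c u ≡ true →
              Σ (Fin n) λ r → isRep G r ≡ true × coComp G r u ≡ true
    descend (suc bound) c c<bound cu with isRep G c in rep
    ... | true  = c , rep , cu
    ... | false with any-elim _ (allFin n) (not-false rep)
    ... | w , w<c∧cw =
      descend bound w (≤-trans (<ᵇ⇒< _ _ (≡true⇒T (∧-elimˡ _ w<c∧cw))) (s≤s⁻¹ c<bound))
                      (coComp-trans (coComp-sym (∧-elimʳ (toℕ w <ᵇ toℕ c) w<c∧cw)) cu)

-- Compatible walks

module ArcWalks {n : ℕ} (G : Graph n) where

  _∈ᵀ_ : Triple G → List (Triple G) → Set
  t ∈ᵀ T = _∈T_ G t T

  _⊆ᵀ_ : List (Triple G) → List (Triple G) → Set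
  T ⊆ᵀ T′ = ∀ {t} → t ∈ᵀ T → t ∈ᵀ T′

  adj-flip : ∀ {a b} → adj G a b ≡ true → adj G b a ≡ true
  adj-flip {a} {b} ab = trans (adj-sym G b a) ab

  SameTransition-flip : ∀ {a b c} t → SameTransition G (a , b , c) t → SameTransition G (c , b , a) t
  SameTransition-flip _ (inj₁ (a≡ , b≡ , c≡)) = inj₂ (c≡ , b≡ , a≡)
  SameTransition-flip _ (inj₂ (a≡ , b≡ , c≡)) = inj₁ (c≡ , b≡ , a≡)

  -- ArcWalk T a b c d: a T-compatible walk whose first arc is ab and whose last arc is cd.
  data ArcWalk (T : List (Triple G)) : Fin n → Fin n → Fin n → Fin n → Set where
    arc    : ∀ {a b} → adj G a b ≡ true → ArcWalk T a b a b
    extend : ∀ {a b c d e} → ((a , b , c) ∈ᵀ T ⊎ a ≡ c) → adj G a b ≡ true →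
             ArcWalk T b c d e → ArcWalk T a b d e

  module _ {T : List (Triple G)} where

    first-arc : ∀ {a b c d} → ArcWalk T a b c d → adj G a b ≡ true
    first-arc (arc ab)        = ab
    first-arc (extend _ ab _) = ab

    last-arc : ∀ {a b c d} → ArcWalk T a b c d → adj G c d ≡ true
    last-arc (arc cd)          = cd
    last-arc (extend _ _ rest) = last-arc rest

    _++ᵃ_ : ∀ {a b c d e f} → ArcWalk T a b c d → ArcWalk T c d e f → ArcWalk T a b e f
    arc _               ++ᵃ w = w
    extend turn ab rest ++ᵃ w = extend turn ab (rest ++ᵃ w)

    u-turn : ∀ {a b} → adj G a b ≡ true → ArcWalk T a b b a
    u-turn ab = extend (inj₂ refl) ab (arc (adj-flip ab))

    through : ∀ {a b c} → (a , b , c) ∈ᵀ T → adj G a b ≡ true → adj G b c ≡ true →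
              ArcWalk T a b b c
    through abc ab bc = extend (inj₁ abc) ab (arc bc)

    reverse : ∀ {a b c d} → ArcWalk T a b c d → ArcWalk T d c b a
    reverse (arc ab)                    = arc (adj-flip ab)
    reverse (extend (inj₁ abc) ab rest) = reverse rest ++ᵃ
      through (Any.map (SameTransition-flip _) abc) (adj-flip (first-arc rest)) (adj-flip ab)
    reverse (extend (inj₂ refl) ab rest) = reverse rest ++ᵃ u-turn ab

    vertices-after-first-arc : ∀ {a b c d} → ArcWalk T a b c d → List (Fin n)
    vertices-after-first-arc (arc _)                 = []
    vertices-after-first-arc (extend {c = c} _ _ rest) = c ∷ vertices-after-first-arc rest

    toCompatibleWalk : ∀ {a b c d} (w : ArcWalk T a b c d) →
                       Σ (List (Fin n)) λ xs → WalkFromTo G a d xs × Compatible G T xs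
    toCompatibleWalk {a} {b} w =
      a ∷ b ∷ vertices-after-first-arc w , (is-walk w , refl , ends w) , compatible w
      where
      is-walk : ∀ {a b c d} (w : ArcWalk T a b c d) → IsWalk G (a ∷ b ∷ vertices-after-first-arc w)
      is-walk (arc {a} {b} ab)           = step a b [] ab (single b)
      is-walk (extend {a} {b} _ ab rest) = step a b _ ab (is-walk rest)
      ends : ∀ {a b c d} (w : ArcWalk T a b c d) → last (a ∷ b ∷ vertices-after-first-arc w) ≡ just d
      ends (arc _)           = refl
      ends (extend _ _ rest) = ends rest
      compatible : ∀ {a b c d} (w : ArcWalk T a b c d) →
                   Compatible G T (a ∷ b ∷ vertices-after-first-arc w)
      compatible (arc {a} {b} _)                  = two a b
      compatible (extend {a} {b} {c} turn _ rest) = more a b c _ turn (compatible rest)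

  weaken : ∀ {T T′} → T ⊆ᵀ T′ → ∀ {a b c d} → ArcWalk T a b c d → ArcWalk T′ a b c d
  weaken T⊆T′ (arc ab)                    = arc ab
  weaken T⊆T′ (extend (inj₁ abc) ab rest) = extend (inj₁ (T⊆T′ abc)) ab (weaken T⊆T′ rest)
  weaken T⊆T′ (extend (inj₂ a≡c) ab rest) = extend (inj₂ a≡c) ab (weaken T⊆T′ rest)

-- Transition sets that connect one co-connected component

module Spanning {n : ℕ} (G : Graph n) where
  open ArcWalks G

  Ends : (Fin n → Bool) → Triple G → Set
  Ends C (a , _ , c) = C a ≡ true × C c ≡ true

  record Anchor (T : List (Triple G)) (C : Fin n → Bool) : Set where
    field
      h₁ h₂      : Fin n
      h-adj      : adj G h₁ h₂ ≡ true
      reach-from : ∀ c → C c ≡ true → Σ (Fin n) λ y → ArcWalk T h₁ h₂ y c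

  anchor-mono : ∀ {T T′ C} → T ⊆ᵀ T′ → Anchor T C → Anchor T′ C
  anchor-mono T⊆T′ A = record
    { h₁ = h₁ ; h₂ = h₂ ; h-adj = h-adj
    ; reach-from = λ c c∈C → let y , w = reach-from c c∈C in y , weaken T⊆T′ w }
    where open Anchor A

  anchor⇒walk : ∀ {T C u v} → Anchor T C → C u ≡ true → C v ≡ true →
                Σ (List (Fin n)) λ xs → WalkFromTo G u v xs × Compatible G T xs
  anchor⇒walk {u = u} {v} A u∈C v∈C =
    toCompatibleWalk (reverse (proj₂ (reach-from u u∈C)) ++ᵃ
                      (u-turn (adj-flip h-adj) ++ᵃ proj₂ (reach-from v v∈C)))
    where open Anchor A

  record SpanningSet (C : Fin n → Bool) (m : ℕ) : Set where
    field
      transitions    : List (Triple G)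
      size           : length transitions ≡ m
      transition-set : IsTransitionSet G transitions
      ends           : All (Ends C) transitions
      anchor         : Anchor transitions C

-- The case G[C] connected: a tree grown inside C from an edge h₁h₂

module TreeSpanning {n : ℕ} (G : Graph n) (C : Fin n → Bool)
    (C-connected : ∀ {a b} → C a ≡ true → C b ≡ true →
                   Σ ℕ λ k → Reach.Reachable G (adj G) C k a b)
    where
  open Reach G (adj G) C
  open ArcWalks G
  open Spanning G

  record Tree : Set where
    field
      S              : Fin n → Bool
      S⊆C            : S ⊆ᵇ C
      transitions    : List (Triple G)
      size           : count S (allFin n) ≡ 2 + length transitions
      transition-set : IsTransitionSet G transitions
      ends           : All (Ends S) transitions
      h₁ h₂          : Fin n
      h-adj          : adj G h₁ h₂ ≡ true
      h₁∈S           : S h₁ ≡ true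
      reach-from     : ∀ w → S w ≡ true →
                       Σ (Fin n) λ y → S y ≡ true × ArcWalk transitions h₁ h₂ y w
  open Tree

  order : Tree → ℕ
  order t = count (S t) (allFin n)

  seed : ∀ {s w} → C s ≡ true → C w ≡ true → adj G s w ≡ true → Tree
  seed {s} {w} s∈C w∈C sw = record
    { S = insert w (insert s ∅)
    ; S⊆C = λ x x∈ → [ (λ { refl → s∈C }) , (λ { refl → w∈C }) ]′ (pair-elim s w x x∈)
    ; transitions = []
    ; size = count-pair w≢s
    ; transition-set = [] , []
    ; ends = []
    ; h₁ = s ; h₂ = w ; h-adj = sw
    ; h₁∈S = s∈S
    ; reach-from = reach-seed }
    where
    w≢s : s ≢ w
    w≢s refl = absurd-bool sw (adj-irrefl G s)
    s∈S : insert w (insert s ∅) s ≡ true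
    s∈S = insert-there w (insert s ∅) (insert-here s ∅)
    reach-seed : ∀ x → insert w (insert s ∅) x ≡ true →
                 Σ (Fin n) λ y → insert w (insert s ∅) y ≡ true × ArcWalk [] s w y x
    reach-seed x x∈ with pair-elim s w x x∈
    ... | inj₁ refl = w , insert-here w (insert s ∅) , u-turn sw
    ... | inj₂ refl = s , s∈S , arc sw

  add-leaf : (t : Tree) → ∀ {s w y} → S t s ≡ true → S t w ≡ false → adj G s w ≡ true →
             C w ≡ true → S t y ≡ true → ArcWalk (transitions t) (h₁ t) (h₂ t) y s → Tree
  add-leaf t {s} {w} {y} s∈S w∉S sw w∈C y∈S walk = record
    { S = S′
    ; S⊆C = λ x x∈ → [ S⊆C t x , (λ { refl → w∈C }) ]′ (insert-elim w (S t) x x∈)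
    ; transitions = (y , s , w) ∷ transitions t
    ; size = trans (count-insert (S t) w w∉S) (cong suc (size t))
    ; transition-set = (last-arc walk , sw , y≢w) ∷ proj₁ (transition-set t)
                     , All.map new-is-fresh (ends t) ∷ proj₂ (transition-set t)
    ; ends = (in-S′ y∈S , insert-here w (S t)) ∷
             All.map (λ (a∈ , c∈) → in-S′ a∈ , in-S′ c∈) (ends t)
    ; h₁ = h₁ t ; h₂ = h₂ t ; h-adj = h-adj t ; h₁∈S = in-S′ (h₁∈S t)
    ; reach-from = reach-from′ }
    where
    S′ : Fin n → Bool
    S′ = insert w (S t)
    in-S′ : ∀ {x} → S t x ≡ true → S′ x ≡ true
    in-S′ = insert-there w (S t)
    y≢w : y ≢ w
    y≢w refl = absurd-bool y∈S w∉S
    new-is-fresh : ∀ {t′} → Ends (S t) t′ → ¬ SameTransition G (y , s , w) t′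
    new-is-fresh (_ , c∈S) (inj₁ (_ , _ , refl)) = absurd-bool c∈S w∉S
    new-is-fresh (a∈S , _) (inj₂ (_ , _ , refl)) = absurd-bool a∈S w∉S
    reach-from′ : ∀ x → S′ x ≡ true →
                  Σ (Fin n) λ y′ → S′ y′ ≡ true ×
                                   ArcWalk ((y , s , w) ∷ transitions t) (h₁ t) (h₂ t) y′ x
    reach-from′ x x∈ with insert-elim w (S t) x x∈
    ... | inj₁ x∈S =
      let y′ , y′∈S , walk′ = reach-from t x x∈S in y′ , in-S′ y′∈S , weaken there walk′
    ... | inj₂ refl =
      s , in-S′ s∈S , weaken there walk ++ᵃ through (here (inj₁ (refl , refl , refl))) (last-arc walk) sw

  extend-tree : (t : Tree) → order t < count C (allFin n) →
                Σ Tree λ t′ → order t′ ≡ suc (order t)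
  extend-tree t lt with count-<⇒witness (allFin n) lt
  ... | c , c∈C , c∉S with C-connected (S⊆C t (h₁ t) (h₁∈S t)) c∈C
  ... | _ , path with reach-exit (S t) path (h₁∈S t) c∉S
  ... | s , w , s∈S , w∉S , sw , w∈C with reach-from t s s∈S
  ... | y , y∈S , walk = t′ , trans (size t′) (cong suc (sym (size t)))
    where
    t′ : Tree
    t′ = add-leaf t s∈S w∉S sw w∈C y∈S walk

  grow : ∀ d (t : Tree) → order t + d ≡ count C (allFin n) →
         Σ Tree λ t′ → order t′ ≡ count C (allFin n)
  grow zero    t eq = t , trans (sym (+-identityʳ _)) eq
  grow (suc d) t eq with extend-tree t (subst (order t <_) eq (m<m+n (order t) z<s))
  ... | t′ , grown = grow d t′ (trans (cong (_+ d) grown) (trans (sym (+-suc _ d)) eq))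

  edge-inside : 2 ≤ count C (allFin n) →
                Σ (Fin n) λ s → Σ (Fin n) λ w → C s ≡ true × C w ≡ true × adj G s w ≡ true
  edge-inside C≥2 with member (<⇒≤ C≥2)
  ... | r , r∈C with other-member r C≥2
  ... | c , c∈C , c∉r with C-connected r∈C c∈C
  ... | _ , path with reach-exit (insert r ∅) path (insert-here r ∅) c∉r
  ... | s , w , s∈r , _ , sw , w∈C with ≟-sound s∈r
  ... | refl = s , w , r∈C , w∈C , sw

  tree-spanning : 2 ≤ count C (allFin n) → SpanningSet C (count C (allFin n) ∸ 2)
  tree-spanning C≥2 with edge-inside C≥2
  ... | s , w , s∈C , w∈C , sw
    with grow (count C (allFin n) ∸ 2) (seed s∈C w∈C sw)
              (trans (cong (_+ _) (size (seed s∈C w∈C sw))) (m+[n∸m]≡n C≥2))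
  ... | t , full = record
    { transitions = transitions t
    ; size = sym (trans (cong (_∸ 2) (trans (sym full) (size t)))
                        (m+n∸m≡n 2 (length (transitions t))))
    ; transition-set = transition-set t
    ; ends = All.map (λ (a∈ , c∈) → S⊆C t _ a∈ , S⊆C t _ c∈) (ends t)
    ; anchor = record
      { h₁ = h₁ t ; h₂ = h₂ t ; h-adj = h-adj t
      ; reach-from = λ c c∈C →
          let y , _ , walk = reach-from t c (count-≡⇒⊇ (allFin n) (S⊆C t) full (∈-allFin c) c∈C)
          in y , walk } }

-- The case G[C] disconnected: a star of transitions through a vertex x adjacent to all of C

module StarSpanning {n : ℕ} (G : Graph n) (C : Fin n → Bool) (x : Fin n)
    (x-joined : ∀ {c} → C c ≡ true → adj G x c ≡ true) where
  open ArcWalks G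
  open Spanning G

  star-spanning : (cs : List (Fin n)) → 1 ≤ length cs → Unique cs → All (λ c → C c ≡ true) cs →
                  (∀ {c} → C c ≡ true → c ∈ cs) → SpanningSet C (length cs ∸ 1)
  star-spanning (c₁ ∷ cs) _ (c₁∉cs ∷ unique) (c₁∈C ∷ cs⊆C) complete = record
    { transitions = map spoke cs
    ; size = length-map spoke cs
    ; transition-set =
        All.map⁺ (All.zipWith (λ (c₁≢c , c∈C) → c₁x , x-joined c∈C , c₁≢c)
                              (c₁∉cs , cs⊆C)) ,
        AllPairs.map⁺ (AllPairs.map spokes-distinct unique)
    ; ends = All.map⁺ (All.map (λ c∈C → c₁∈C , c∈C) cs⊆C)
    ; anchor = record
      { h₁ = c₁ ; h₂ = x ; h-adj = c₁x ; reach-from = λ c c∈C → x , spoke-walk (complete c∈C) } }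
    where
    spoke : Fin n → Triple G
    spoke c = c₁ , x , c
    c₁x : adj G c₁ x ≡ true
    c₁x = adj-flip (x-joined c₁∈C)
    spokes-distinct : ∀ {c c′} → c ≢ c′ → ¬ SameTransition G (spoke c) (spoke c′)
    spokes-distinct c≢c′ (inj₁ (_ , _ , c≡c′))     = c≢c′ c≡c′
    spokes-distinct c≢c′ (inj₂ (c₁≡c′ , _ , c≡c₁)) = c≢c′ (trans c≡c₁ c₁≡c′)
    spoke-walk : ∀ {c} → c ∈ c₁ ∷ cs → ArcWalk (map spoke cs) c₁ x x c
    spoke-walk (here refl)  = u-turn c₁x
    spoke-walk (there c∈cs) =
      through (Any.map⁺ (Any.map (λ { refl → inj₁ (refl , refl , refl) }) c∈cs))
              c₁x (x-joined (All.lookup cs⊆C c∈cs))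

-- Assembling the components

module Assembly {n : ℕ} (G : Graph n) (connected : Connected G) where
  open CoComponents G
  open ArcWalks G
  open Spanning G

  eligible : Fin n → Bool
  eligible r = isRep G r ∧ (2 ≤ᵇ coCompSize G r)

  -- Only representatives own transitions, which makes the blocks of distinct vertices disjoint.
  Owned : Fin n → Triple G → Set
  Owned r t = isRep G r ≡ true × Ends (coComp G r) t

  record Block (r : Fin n) : Set where
    field
      transitions    : List (Triple G)
      size           : length transitions ≡ contribution G r
      transition-set : IsTransitionSet G transitions
      owned          : All (Owned r) transitions
      anchor         : eligible r ≡ true → Anchor transitions (coComp G r)

  owner-unique : ∀ {r r′ t s} → Owned r t → Owned r′ s → SameTransition G t s → r ≡ r′
  owner-unique (rep , ra , _) (rep′ , r′a , _) (inj₁ (refl , _ , _)) =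
    isRep-unique rep rep′ (coComp-trans ra (coComp-sym r′a))
  owner-unique (rep , ra , _) (rep′ , _ , r′a) (inj₂ (refl , _ , _)) =
    isRep-unique rep rep′ (coComp-trans ra (coComp-sym r′a))

  induced-connected-elim : ∀ {r a b} → inducedConnected G r ≡ true →
                           coComp G r a ≡ true → coComp G r b ≡ true →
                           Reach.Reachable G (adj G) (coComp G r) n a b
  induced-connected-elim {a = a} {b} ic ra rb = Reach.reachable
    (implication-elim (all-elim _ (allFin n) (all-elim _ (allFin n) ic (∈-allFin a)) (∈-allFin b)) ra rb)

  induced-connected-intro : ∀ {r} → (∀ a b → Reach.Reachable G (adj G) (coComp G r) n a b) →
                            inducedConnected G r ≡ true
  induced-connected-intro reachable-everywhere =
    all-intro _ (allFin n) λ a → all-intro _ (allFin n) λ b →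
      ∨-introʳ _ (Reach.holds (reachable-everywhere a b))

  connected-reachable : ∀ (S : Fin n → Bool) → (∀ v → S v ≡ true) →
                        ∀ a b → Reach.Reachable G (adj G) S n a b
  connected-reachable S full a b =
    let xs , (walk , first , final) = connected a b
    in Reach.reach-saturates G (adj G) S (proj₂ (walk⇒reach G S full xs walk first final))

  -- If C were all of V(G), then G[C] = G would be connected.
  outsider : ∀ {r} → inducedConnected G r ≡ false → Σ (Fin n) λ x → coComp G r x ≡ false
  outsider {r} ic with all? (λ x → coComp G r x ≟ᵇ true)
  ... | yes everywhere =
    absurd-bool (induced-connected-intro (connected-reachable (coComp G r) everywhere)) ic
  ... | no ¬everywhere =
    let x , x∉ = ¬∀⟶∃¬ n _ (λ x → coComp G r x ≟ᵇ true) ¬everywhere in x , ¬-not x∉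

  component : Fin n → List (Fin n)
  component r = filter (λ w → coComp G r w ≟ᵇ true) (allFin n)

  eligible-rep : ∀ {r} → eligible r ≡ true → isRep G r ≡ true
  eligible-rep {r} = ∧-elimˡ (isRep G r)

  eligible-size : ∀ {r} → eligible r ≡ true → 2 ≤ coCompSize G r
  eligible-size {r} el = ≤ᵇ⇒≤ 2 _ (≡true⇒T (∧-elimʳ (isRep G r) el))

  contribution-cases : ∀ {r b c} → eligible r ≡ b → inducedConnected G r ≡ c →
                       contribution G r ≡
                         (if b then (if c then coCompSize G r ∸ 2 else coCompSize G r ∸ 1) else 0)
  contribution-cases {r} =
    cong₂ (λ b c → if b then (if c then coCompSize G r ∸ 2 else coCompSize G r ∸ 1) else 0)

  spanning-block : ∀ {r m} → isRep G r ≡ true → SpanningSet (coComp G r) m →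
                   contribution G r ≡ m → Block r
  spanning-block rep sp eq = record
    { transitions = transitions ; size = trans size (sym eq) ; transition-set = transition-set
    ; owned = All.map (rep ,_) ends ; anchor = λ _ → anchor }
    where open SpanningSet sp

  empty-block : ∀ {r} → eligible r ≡ false → Block r
  empty-block el = record
    { transitions = [] ; size = sym (contribution-cases el refl) ; transition-set = [] , []
    ; owned = [] ; anchor = λ el′ → absurd-bool el′ el }

  tree-block : ∀ {r} → eligible r ≡ true → inducedConnected G r ≡ true → Block r
  tree-block {r} el ic = spanning-block (eligible-rep el)
    (TreeSpanning.tree-spanning G (coComp G r) (λ ra rb → n , induced-connected-elim ic ra rb)
                                (eligible-size el))
    (contribution-cases el ic)

  star-block : ∀ {r} → eligible r ≡ true → inducedConnected G r ≡ false → Block r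
  star-block {r} el ic with outsider ic
  ... | x , rx = spanning-block (eligible-rep el)
    (StarSpanning.star-spanning G (coComp G r) x (λ rc → outside⇒adjacent rc rx) (component r)
      (<⇒≤ (eligible-size el))
      (filter⁺ (λ w → coComp G r w ≟ᵇ true) (allFin⁺ n))
      (all-filter (λ w → coComp G r w ≟ᵇ true) (allFin n))
      (∈-filter⁺ (λ w → coComp G r w ≟ᵇ true) (∈-allFin _)))
    (contribution-cases el ic)

  block : ∀ r → Block r
  block r with eligible r in el | inducedConnected G r in ic
  ... | false | _     = empty-block el
  ... | true  | true  = tree-block el ic
  ... | true  | false = star-block el ic

  block-transitions : Fin n → List (Triple G)
  block-transitions r = Block.transitions (block r)

  all-transitions : List (Triple G)
  all-transitions = concat (map block-transitions (allFin n))

  blocks-disjoint : ∀ {r r′} → r ≢ r′ →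
                    All (λ t → All (λ s → ¬ SameTransition G t s) (block-transitions r′))
                        (block-transitions r)
  blocks-disjoint {r} {r′} r≢r′ =
    All.map (λ owned-t → All.map (λ owned-s same → r≢r′ (owner-unique owned-t owned-s same))
                                 (Block.owned (block r′)))
            (Block.owned (block r))

  all-transitions-set : IsTransitionSet G all-transitions
  all-transitions-set =
    All.concat⁺ (All.map⁺ (All.universal (proj₁ ∘ block-transition-set) (allFin n))) ,
    AllPairs.concat⁺ (All.map⁺ (All.universal (proj₂ ∘ block-transition-set) (allFin n)))
                     (AllPairs.map⁺ (AllPairs.map blocks-disjoint (allFin⁺ n)))
    where
    block-transition-set : ∀ r → IsTransitionSet G (block-transitions r)
    block-transition-set r = Block.transition-set (block r)

  all-transitions-size : length all-transitions ≡ τ G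
  all-transitions-size = length-concat-map (λ r → Block.size (block r)) (allFin n)

  ⊆-all-transitions : ∀ {r} → block-transitions r ⊆ᵀ all-transitions
  ⊆-all-transitions {r} t∈ = Any.concat⁺ (Any.map⁺ (lose (∈-allFin r) t∈))

  connecting : ∀ u v →
               Σ (List (Fin n)) λ w → WalkFromTo G u v w × Compatible G all-transitions w
  connecting u v with u ≟ v
  ... | yes refl = u ∷ [] , (single u , refl , refl) , one u
  ... | no u≢v with adj G u v in uv
  ... | true  = u ∷ v ∷ [] , (step u v [] uv (single v) , refl , refl) , two u v
  ... | false with representative u
  ... | r , rep , ru = anchor⇒walk (anchor-mono ⊆-all-transitions (Block.anchor (block r) el)) ru rv
    where
    rv : coComp G r v ≡ true
    rv = coComp-trans ru (coAdj⇒coComp (nonadjacent⇒coAdj uv u≢v))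
    el : eligible r ≡ true
    el = ∧-intro rep (T⇒≡true (≤⇒≤ᵇ (two≤count u≢v ru rv)))

theorem3 : (n : ℕ) → 2 ≤ n → (G : Graph n) → Connected G →
           Σ (List (Triple G)) (λ T → IsConnectingTransitionSet G T × length T ≡ τ G)
theorem3 n _ G connected =
  all-transitions , (all-transitions-set , connecting) , all-transitions-size
  where open Assembly G connected
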